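{- If $r\ge 4$, then $\mathrm{ex}(n,S_r,C_4)=\binom{n-1}{r-1}$.
   Context: $S_r$ is the star on $r$ vertices (one center joined to $r-1$ leaves); $C_4$ is the cycle on $4$ vertices. $\mathcal{N}(H,G)$ is the number of subgraphs of $G$ isomorphic to $H$; $\mathrm{ex}(n,H,F)$ is the maximum of $\mathcal{N}(H,G)$ over $F$-free $n$-vertex graphs $G$. -}

module Defs where

open import Data.Bool using (Bool; true; false; _∧_; _∨_; not; T)
open import Data.Nat using (ℕ; zero; suc; _∸_; _≡ᵇ_)
open import Data.Fin using (Fin)
open import Data.Fin.Subset using (Subset; inside; outside; ∣_∣)
open import Data.Vec using (Vec; []; _∷_; lookup)
open import Data.List using (List; []; _∷_; concatMap; allFin; cartesianProduct; filterᵇ; length)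
open import Data.Bool.ListAction using (all)
open import Data.Product using (_×_; _,_; ∃-syntax)
open import Relation.Binary.PropositionalEquality using (_≡_; _≢_)
open import Relation.Nullary using (¬_)

record Graph (n : ℕ) : Set where
  field
    adj    : Fin n → Fin n → Bool
    sym    : ∀ i j → adj i j ≡ adj j i
    irrefl : ∀ i → adj i i ≡ false
open Graph public

allSubsets : (n : ℕ) → List (Subset n)
allSubsets zero = [] ∷ []
allSubsets (suc n) = concatMap (λ s → (outside ∷ s) ∷ (inside ∷ s) ∷ []) (allSubsets n)

isStarCopy : ∀ {n} → Graph n → ℕ → Fin n × Subset n → Bool
isStarCopy {n} G r (v , L) =
  (∣ L ∣ ≡ᵇ (r ∸ 1)) ∧ not (inL v) ∧ all (λ i → not (inL i) ∨ adj G v i) (allFin n)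
  where
    inL : Fin n → Bool
    inL i = lookup L i

-- N(S_r, G): the number of subgraphs of G isomorphic to the star S_r (r ≥ 3),
-- each such subgraph being determined by its centre and its leaf set.
starCount : ∀ {n} → Graph n → ℕ → ℕ
starCount {n} G r = length (filterᵇ (isStarCopy G r) (cartesianProduct (allFin n) (allSubsets n)))

HasC4 : ∀ {n} → Graph n → Set
HasC4 {n} G = ∃[ a ] ∃[ b ] ∃[ c ] ∃[ d ]
  ( (a ≢ b) × (a ≢ c) × (a ≢ d) × (b ≢ c) × (b ≢ d) × (c ≢ d)
  × T (adj G a b) × T (adj G b c) × T (adj G c d) × T (adj G d a) )

C4Free : ∀ {n} → Graph n → Set
C4Free G = ¬ HasC4 G

{-# OPTIONS --safe #-}
module Submission where

-- Single out the vertex 0. A copy of S_r is a centre v with a leaf set L, and we send it to the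
-- (r-1)-subset of the other n-1 vertices obtained from L by replacing the leaf 0, if present,
-- by the centre v. In a C4-free graph two distinct vertices have at most one common neighbour;
-- since r-1 ≥ 3 this makes the map injective, so N(S_r, G) ≤ C(n-1, r-1). The star K_{1,n-1}
-- centred at 0 is C4-free and attains the bound: every (r-1)-set of leaves spans a copy.

open import Defs hiding (sym)
open import Data.Bool using (Bool; true; false; T; not; _∨_)
open import Data.Bool.Properties using (T-∧)
open import Data.Empty using (⊥-elim)
open import Data.Fin using (Fin; zero; suc)
open import Data.Fin.Properties using (suc-injective; _≟_; 0≢1+n)
open import Data.Fin.Subset using (Subset; inside; outside; ∣_∣; ⁅_⁆; _∪_; _⊆_; Nonempty)
open import Data.Fin.Subset.Properties using (x∈p∪q⁺; x∈p∪q⁻; x∈⁅x⁆; x∈⁅y⁆⇒x≡y; ⊆-antisym; ∪-identityʳ)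
open import Data.List using (List; []; _∷_; _++_; map; concatMap; filterᵇ; length; allFin; cartesianProduct)
open import Data.List.Properties using (length-map; length-++-sucʳ; filter-none)
open import Data.List.Relation.Unary.All using (All; []; _∷_)
import Data.List.Relation.Unary.All as All
import Data.List.Relation.Unary.All.Properties as All
open import Data.List.Relation.Unary.Any using (here; there)
open import Data.List.Relation.Unary.AllPairs using ([]; _∷_)
open import Data.List.Relation.Unary.Unique.Propositional using (Unique)
open import Data.List.Relation.Unary.Unique.Propositional.Properties using (filter⁺; allFin⁺; cartesianProduct⁺)
open import Data.Nat using (ℕ; zero; suc; _+_; _∸_; _≤_; _<_; _≡ᵇ_; z≤n; s≤s)
open import Data.Nat.Combinatorics using (_C_; nCk+nC[k+1]≡[n+1]C[k+1])
open import Data.Nat.Properties using (≤-antisym; <⇒≤; ≤-pred; +-comm; +-suc; ≡ᵇ⇒≡; ≡⇒≡ᵇ; module ≤-Reasoning)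
open import Data.Product using (Σ; ∃; ∃₂; _×_; _,_; proj₁; proj₂)
open import Data.Sum using (_⊎_; inj₁; inj₂; [_,_])
open import Data.Vec using ([]; _∷_; lookup; tail)
open import Data.Vec.Properties using ([]=⇒lookup; lookup⇒[]=)
open import Function using (_∘_; Equivalence)
open import Relation.Binary.PropositionalEquality
  using (_≡_; _≢_; refl; sym; trans; cong; cong₂; subst; module ≡-Reasoning)
open import Relation.Nullary using (yes; no)
open import Relation.Nullary.Decidable using (T?)

private
  variable
    A B : Set
    m n k : ℕ

centredSubsets : ∀ n → List (Fin n × Subset n)
centredSubsets n = cartesianProduct (allFin n) (allSubsets n)

module _ where
  open import Data.List.Membership.Propositional using (_∈_)
  open import Data.List.Membership.Propositional.Properties
    using (∈-∃++; ∈-++⁻; ∈-++⁺ˡ; ∈-++⁺ʳ; ∈-map⁻; ∈-filter⁺; ∈-filter⁻; ∈-allFin; ∈-cartesianProduct⁺)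

  Unique-⊆⇒length-≤ : {xs ys : List A} → Unique xs → (∀ {x} → x ∈ xs → x ∈ ys) → length xs ≤ length ys
  Unique-⊆⇒length-≤ {xs = []} _ _ = z≤n
  Unique-⊆⇒length-≤ {xs = x ∷ xs} (x∉xs ∷ xs!) xs⊆ys with as , bs , refl ← ∈-∃++ (xs⊆ys (here refl)) =
    begin
      suc (length xs)         ≤⟨ s≤s (Unique-⊆⇒length-≤ xs! xs⊆as++bs) ⟩
      suc (length (as ++ bs)) ≡⟨ length-++-sucʳ as x bs ⟨
      length (as ++ x ∷ bs)   ∎
    where
    open ≤-Reasoning
    xs⊆as++bs : ∀ {y} → y ∈ xs → y ∈ as ++ bs
    xs⊆as++bs y∈xs with ∈-++⁻ as (xs⊆ys (there y∈xs))
    ... | inj₁ y∈as         = ∈-++⁺ˡ y∈as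
    ... | inj₂ (here refl)  = ⊥-elim (All.lookup x∉xs y∈xs refl)
    ... | inj₂ (there y∈bs) = ∈-++⁺ʳ as y∈bs

  Unique-map-injectiveOn : (f : A → B) {xs : List A} →
    (∀ {x y} → x ∈ xs → y ∈ xs → f x ≡ f y → x ≡ y) → Unique xs → Unique (map f xs)
  Unique-map-injectiveOn f {[]} _ [] = []
  Unique-map-injectiveOn f {x ∷ xs} inj (x∉xs ∷ xs!) =
    All.map⁺ (All.tabulate λ y∈xs fx≡fy → All.lookup x∉xs y∈xs (inj (here refl) (there y∈xs) fx≡fy))
    ∷ Unique-map-injectiveOn f (λ x∈xs y∈xs → inj (there x∈xs) (there y∈xs)) xs!

  length-filterᵇ-≤-injection : (P : A → Bool) (Q : B → Bool) (f : A → B) {xs : List A} {ys : List B} →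
    Unique xs → (∀ y → y ∈ ys) →
    (∀ x → T (P x) → T (Q (f x))) →
    (∀ x y → T (P x) → T (P y) → f x ≡ f y → x ≡ y) →
    length (filterᵇ P xs) ≤ length (filterᵇ Q ys)
  length-filterᵇ-≤-injection P Q f {xs} {ys} xs! ∈ys P⇒Q∘f inj = begin
    length (filterᵇ P xs)         ≡⟨ length-map f (filterᵇ P xs) ⟨
    length (map f (filterᵇ P xs)) ≤⟨ Unique-⊆⇒length-≤ image! image⊆ ⟩
    length (filterᵇ Q ys)         ∎
    where
    open ≤-Reasoning
    P-of : ∀ {x} → x ∈ filterᵇ P xs → T (P x)
    P-of = proj₂ ∘ ∈-filter⁻ (T? ∘ P) {xs = xs}
    image! : Unique (map f (filterᵇ P xs))
    image! = Unique-map-injectiveOn f (λ x∈ y∈ → inj _ _ (P-of x∈) (P-of y∈)) (filter⁺ (T? ∘ P) xs!)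
    image⊆ : ∀ {y} → y ∈ map f (filterᵇ P xs) → y ∈ filterᵇ Q ys
    image⊆ y∈ with x , x∈ , refl ← ∈-map⁻ f y∈ = ∈-filter⁺ (T? ∘ Q) (∈ys (f x)) (P⇒Q∘f x (P-of x∈))

  extensions : Subset m → List (Subset (suc m))
  extensions s = (outside ∷ s) ∷ (inside ∷ s) ∷ []

  ∈-concatMap-extensions⁺ : ∀ b {s : Subset m} xs → s ∈ xs → b ∷ s ∈ concatMap extensions xs
  ∈-concatMap-extensions⁺ false (_ ∷ _) (here refl) = here refl
  ∈-concatMap-extensions⁺ true  (_ ∷ _) (here refl) = there (here refl)
  ∈-concatMap-extensions⁺ b     (_ ∷ xs) (there s∈xs) = there (there (∈-concatMap-extensions⁺ b xs s∈xs))

  ∈-concatMap-extensions⁻ : ∀ {b} {s : Subset m} xs → b ∷ s ∈ concatMap extensions xs → s ∈ xs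
  ∈-concatMap-extensions⁻ (_ ∷ _)  (here refl)         = here refl
  ∈-concatMap-extensions⁻ (_ ∷ _)  (there (here refl)) = here refl
  ∈-concatMap-extensions⁻ (_ ∷ xs) (there (there bs∈)) = there (∈-concatMap-extensions⁻ xs bs∈)

  Unique-concatMap-extensions : {xs : List (Subset m)} → Unique xs → Unique (concatMap extensions xs)
  Unique-concatMap-extensions {xs = []} [] = []
  Unique-concatMap-extensions {xs = x ∷ xs} (x∉xs ∷ xs!) =
    ((λ ()) ∷ fresh outside) ∷ fresh inside ∷ Unique-concatMap-extensions xs!
    where
    fresh : ∀ b → All (b ∷ x ≢_) (concatMap extensions xs)
    fresh b = All.tabulate λ { t∈ refl → All.lookup x∉xs (∈-concatMap-extensions⁻ xs t∈) refl }

  ∈-allSubsets : (s : Subset m) → s ∈ allSubsets m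
  ∈-allSubsets []      = here refl
  ∈-allSubsets (b ∷ s) = ∈-concatMap-extensions⁺ b _ (∈-allSubsets s)

  Unique-allSubsets : ∀ m → Unique (allSubsets m)
  Unique-allSubsets zero    = [] ∷ []
  Unique-allSubsets (suc m) = Unique-concatMap-extensions (Unique-allSubsets m)

  ∈-centredSubsets : (vL : Fin n × Subset n) → vL ∈ centredSubsets n
  ∈-centredSubsets (v , L) = ∈-cartesianProduct⁺ (∈-allFin v) (∈-allSubsets L)

  Unique-centredSubsets : ∀ n → Unique (centredSubsets n)
  Unique-centredSubsets n = cartesianProduct⁺ (allFin⁺ n) (Unique-allSubsets n)

ofSize : ℕ → List (Subset m) → List (Subset m)
ofSize k = filterᵇ (λ s → ∣ s ∣ ≡ᵇ k)

length-filterᵇ-concatMap-extensions : (p : Subset (suc m) → Bool) (xs : List (Subset m)) →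
  length (filterᵇ p (concatMap extensions xs))
    ≡ length (filterᵇ (p ∘ (outside ∷_)) xs) + length (filterᵇ (p ∘ (inside ∷_)) xs)
length-filterᵇ-concatMap-extensions p [] = refl
-- p (inside ∷ x) only surfaces in the goal once filter has stepped past outside ∷ x,
-- hence the nested with.
length-filterᵇ-concatMap-extensions p (x ∷ xs)
  with length-filterᵇ-concatMap-extensions p xs | p (outside ∷ x)
... | ih | false with p (inside ∷ x)
...   | false = ih
...   | true  = trans (cong suc ih) (sym (+-suc _ _))
length-filterᵇ-concatMap-extensions p (x ∷ xs) | ih | true with p (inside ∷ x)
...   | false = cong suc ih
...   | true  = cong suc (trans (cong suc ih) (sym (+-suc _ _)))

length-ofSize-allSubsets : ∀ m k → length (ofSize k (allSubsets m)) ≡ m C k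
length-ofSize-allSubsets zero    zero    = refl
length-ofSize-allSubsets zero    (suc k) = refl
length-ofSize-allSubsets (suc m) zero    = begin
  length (ofSize 0 (allSubsets (suc m)))
    ≡⟨ length-filterᵇ-concatMap-extensions _ (allSubsets m) ⟩
  length (ofSize 0 (allSubsets m)) + length (filterᵇ (λ _ → false) (allSubsets m))
    ≡⟨ cong₂ _+_ (length-ofSize-allSubsets m 0) (cong length nothingExtendsToSize0) ⟩
  m C 0 + 0
    ∎
  where
  open ≡-Reasoning
  nothingExtendsToSize0 : filterᵇ (λ _ → false) (allSubsets m) ≡ []
  nothingExtendsToSize0 = filter-none (T? ∘ λ _ → false) (All.universal (λ _ ()) (allSubsets m))
length-ofSize-allSubsets (suc m) (suc k) = begin
  length (ofSize (suc k) (allSubsets (suc m)))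
    ≡⟨ length-filterᵇ-concatMap-extensions _ (allSubsets m) ⟩
  length (ofSize (suc k) (allSubsets m)) + length (ofSize k (allSubsets m))
    ≡⟨ cong₂ _+_ (length-ofSize-allSubsets m (suc k)) (length-ofSize-allSubsets m k) ⟩
  m C suc k + m C k
    ≡⟨ +-comm (m C suc k) (m C k) ⟩
  m C k + m C suc k
    ≡⟨ nCk+nC[k+1]≡[n+1]C[k+1] m k ⟩
  suc m C suc k
    ∎
  where open ≡-Reasoning

-- From here on, ∈ is Subset membership.
open import Data.Fin.Subset using (_∈_; _∉_)
open import Data.Vec using (here; there)

∣p∣>0⇒Nonempty : {p : Subset n} → 0 < ∣ p ∣ → Nonempty p
∣p∣>0⇒Nonempty {p = outside ∷ p} ∣p∣>0 = let x , x∈p = ∣p∣>0⇒Nonempty ∣p∣>0 in suc x , there x∈p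
∣p∣>0⇒Nonempty {p = inside ∷ p}  _     = zero , here

∣p∣>1⇒∃∈≢ : {p : Subset n} → 1 < ∣ p ∣ → ∀ a → ∃ λ x → x ∈ p × x ≢ a
∣p∣>1⇒∃∈≢ {p = inside ∷ p}  (s≤s ∣p∣>0) zero =
  let x , x∈p = ∣p∣>0⇒Nonempty ∣p∣>0 in suc x , there x∈p , λ ()
∣p∣>1⇒∃∈≢ {p = inside ∷ p}  _ (suc a) = zero , here , λ ()
∣p∣>1⇒∃∈≢ {p = outside ∷ p} ∣p∣>1 zero =
  let x , x∈p = ∣p∣>0⇒Nonempty (<⇒≤ ∣p∣>1) in suc x , there x∈p , λ ()
∣p∣>1⇒∃∈≢ {p = outside ∷ p} ∣p∣>1 (suc a) =
  let x , x∈p , x≢a = ∣p∣>1⇒∃∈≢ ∣p∣>1 a in suc x , there x∈p , x≢a ∘ suc-injective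

∣p∣>1⇒∃-distinct : {p : Subset n} → 1 < ∣ p ∣ → ∃₂ λ x y → x ∈ p × y ∈ p × x ≢ y
∣p∣>1⇒∃-distinct ∣p∣>1 =
  let x , x∈p       = ∣p∣>0⇒Nonempty (<⇒≤ ∣p∣>1)
      y , y∈p , y≢x = ∣p∣>1⇒∃∈≢ ∣p∣>1 x
  in x , y , x∈p , y∈p , y≢x ∘ sym

∣p∪⁅x⁆∣≡1+∣p∣ : {p : Subset n} {x : Fin n} → x ∉ p → ∣ p ∪ ⁅ x ⁆ ∣ ≡ suc ∣ p ∣
∣p∪⁅x⁆∣≡1+∣p∣ {p = outside ∷ p} {zero}  _   = cong (suc ∘ ∣_∣) (∪-identityʳ p)
∣p∪⁅x⁆∣≡1+∣p∣ {p = inside ∷ p}  {zero}  x∉p = ⊥-elim (x∉p here)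
∣p∪⁅x⁆∣≡1+∣p∣ {p = outside ∷ p} {suc x} x∉p = ∣p∪⁅x⁆∣≡1+∣p∣ (x∉p ∘ there)
∣p∪⁅x⁆∣≡1+∣p∣ {p = inside ∷ p}  {suc x} x∉p = cong suc (∣p∪⁅x⁆∣≡1+∣p∣ (x∉p ∘ there))

x∈p∪⁅y⁆⇒x∈p : {p : Subset n} {x y : Fin n} → x ∈ p ∪ ⁅ y ⁆ → x ≢ y → x ∈ p
x∈p∪⁅y⁆⇒x∈p {p = p} {y = y} x∈p∪⁅y⁆ x≢y with x∈p∪q⁻ p ⁅ y ⁆ x∈p∪⁅y⁆
... | inj₁ x∈p   = x∈p
... | inj₂ x∈⁅y⁆ = ⊥-elim (x≢y (x∈⁅y⁆⇒x≡y y x∈⁅y⁆))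

∪⁅x⁆-injective : {p q : Subset n} {x : Fin n} → x ∉ p → x ∉ q → p ∪ ⁅ x ⁆ ≡ q ∪ ⁅ x ⁆ → p ≡ q
∪⁅x⁆-injective x∉p x∉q eq = ⊆-antisym (⊆-cancel eq x∉p) (⊆-cancel (sym eq) x∉q)
  where
  ⊆-cancel : ∀ {p q x} → p ∪ ⁅ x ⁆ ≡ q ∪ ⁅ x ⁆ → x ∉ p → p ⊆ q
  ⊆-cancel eq x∉p {y} y∈p =
    x∈p∪⁅y⁆⇒x∈p (subst (y ∈_) eq (x∈p∪q⁺ (inj₁ y∈p))) λ { refl → x∉p y∈p }

Adj : Graph n → Fin n → Fin n → Set
Adj G x y = T (adj G x y)

Adj-sym : (G : Graph n) {x y : Fin n} → Adj G x y → Adj G y x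
Adj-sym G {x} {y} = subst T (Graph.sym G x y)

Adj⇒≢ : (G : Graph n) {x y : Fin n} → Adj G x y → x ≢ y
Adj⇒≢ G {x} x~x refl = subst T (irrefl G x) x~x

C4Free⇒commonNeighbour-unique : (G : Graph n) → C4Free G → {a b x y : Fin n} → a ≢ b →
  Adj G a x → Adj G b x → Adj G a y → Adj G b y → x ≡ y
C4Free⇒commonNeighbour-unique G free {a} {b} {x} {y} a≢b a~x b~x a~y b~y with x ≟ y
... | yes x≡y = x≡y
... | no  x≢y = ⊥-elim (free (a , x , b , y ,
      Adj⇒≢ G a~x , a≢b , Adj⇒≢ G a~y , Adj⇒≢ G b~x ∘ sym , x≢y , Adj⇒≢ G b~y ,
      a~x , Adj-sym G b~x , b~y , Adj-sym G a~y))

record IsStar (G : Graph n) (k : ℕ) (v : Fin n) (L : Subset n) : Set where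
  field
    size     : ∣ L ∣ ≡ k
    centre∉  : v ∉ L
    adjacent : ∀ {x} → x ∈ L → Adj G v x
open IsStar

isStarCopy⇒IsStar : (G : Graph n) (r : ℕ) (vL : Fin n × Subset n) →
  T (isStarCopy G r vL) → IsStar G (r ∸ 1) (proj₁ vL) (proj₂ vL)
isStarCopy⇒IsStar G r (v , L) isStar
  with sized , rest ← Equivalence.to T-∧ isStar
  with v∉L , allAdjacent ← Equivalence.to T-∧ rest = record
  { size     = ≡ᵇ⇒≡ ∣ L ∣ (r ∸ 1) sized
  ; centre∉  = λ v∈L → subst (T ∘ not) ([]=⇒lookup v∈L) v∉L
  ; adjacent = λ {x} x∈L →
      subst (λ b → T (not b ∨ adj G v x)) ([]=⇒lookup x∈L) (All.tabulate⁻ (All.all⁺ _ _ allAdjacent) x)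
  }

IsStar⇒isStarCopy : (G : Graph n) (r : ℕ) (vL : Fin n × Subset n) →
  IsStar G (r ∸ 1) (proj₁ vL) (proj₂ vL) → T (isStarCopy G r vL)
IsStar⇒isStarCopy G r (v , L) star =
  Equivalence.from T-∧ (≡⇒≡ᵇ ∣ L ∣ (r ∸ 1) (size star) ,
    Equivalence.from T-∧ (v∉L , All.all⁻ _ (All.tabulate⁺ leafAdjacent)))
  where
  v∉L : T (not (lookup L v))
  v∉L with lookup L v in eq
  ... | false = _
  ... | true  = centre∉ star (lookup⇒[]= v L eq)
  leafAdjacent : ∀ x → T (not (lookup L x) ∨ adj G v x)
  leafAdjacent x with lookup L x in eq
  ... | false = _
  ... | true  = adjacent star (lookup⇒[]= x L eq)

module _ {G : Graph n} (free : C4Free G) where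

  IsStar-sharedLeaf-unique : {k₁ k₂ : ℕ} {v₁ v₂ x y : Fin n} {L₁ L₂ : Subset n} →
    IsStar G k₁ v₁ L₁ → IsStar G k₂ v₂ L₂ → v₁ ≢ v₂ →
    x ∈ L₁ → x ∈ L₂ → y ∈ L₁ → y ∈ L₂ → x ≡ y
  IsStar-sharedLeaf-unique star₁ star₂ v₁≢v₂ x∈L₁ x∈L₂ y∈L₁ y∈L₂ =
    C4Free⇒commonNeighbour-unique G free v₁≢v₂
      (adjacent star₁ x∈L₁) (adjacent star₂ x∈L₂) (adjacent star₁ y∈L₁) (adjacent star₂ y∈L₂)

  IsStar-centre-unique : {k₁ k₂ : ℕ} {v₁ v₂ : Fin n} {L : Subset n} → 1 < ∣ L ∣ →
    IsStar G k₁ v₁ L → IsStar G k₂ v₂ L → v₁ ≡ v₂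
  IsStar-centre-unique {v₁ = v₁} {v₂} ∣L∣>1 star₁ star₂ with v₁ ≟ v₂
  ... | yes v₁≡v₂ = v₁≡v₂
  ... | no  v₁≢v₂ =
    let x , y , x∈L , y∈L , x≢y = ∣p∣>1⇒∃-distinct ∣L∣>1
    in ⊥-elim (x≢y (IsStar-sharedLeaf-unique star₁ star₂ v₁≢v₂ x∈L x∈L y∈L y∈L))

-- The clause for (zero , inside ∷ L) is junk: a centre is never its own leaf.
replaceZeroByCentre : Fin (suc m) × Subset (suc m) → Subset m
replaceZeroByCentre (_     , outside ∷ L) = L
replaceZeroByCentre (zero  , inside  ∷ L) = L
replaceZeroByCentre (suc v , inside  ∷ L) = L ∪ ⁅ v ⁆

IsStar⇒∣replaceZeroByCentre∣ : {G : Graph (suc m)} {v : Fin (suc m)} {L : Subset (suc m)} →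
  IsStar G k v L → ∣ replaceZeroByCentre (v , L) ∣ ≡ k
IsStar⇒∣replaceZeroByCentre∣ {v = _}     {outside ∷ _} star = size star
IsStar⇒∣replaceZeroByCentre∣ {v = zero}  {inside ∷ _}  star = ⊥-elim (centre∉ star here)
IsStar⇒∣replaceZeroByCentre∣ {v = suc _} {inside ∷ _}  star =
  trans (∣p∪⁅x⁆∣≡1+∣p∣ (centre∉ star ∘ there)) (size star)

IsStar-inside⇒1<∣L∣ : {G : Graph (suc m)} {v : Fin (suc m)} {L : Subset m} →
  2 < k → IsStar G k v (inside ∷ L) → 1 < ∣ L ∣
IsStar-inside⇒1<∣L∣ 2<k star = ≤-pred (subst (2 <_) (sym (size star)) 2<k)

module _ {G : Graph (suc m)} (free : C4Free G) where

  -- The centres differ (suc v₂ is a leaf of the first star), yet both are adjacent to all of L₂.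
  replaceZeroByCentre-separates : {v₁ : Fin (suc m)} {v₂ : Fin m} {L₁ L₂ : Subset m} → 2 < k →
    IsStar G k v₁ (outside ∷ L₁) → IsStar G k (suc v₂) (inside ∷ L₂) →
    replaceZeroByCentre (v₁ , outside ∷ L₁) ≢ replaceZeroByCentre (suc v₂ , inside ∷ L₂)
  replaceZeroByCentre-separates {v₁ = v₁} {v₂} {L₁} {L₂} 2<k star₁ star₂ L₁≡L₂∪⁅v₂⁆ =
    let x , y , x∈L₂ , y∈L₂ , x≢y = ∣p∣>1⇒∃-distinct (IsStar-inside⇒1<∣L∣ 2<k star₂)
    in x≢y (suc-injective (IsStar-sharedLeaf-unique free star₁ star₂ v₁≢1+v₂
         (there (∈L₁ (x∈p∪q⁺ (inj₁ x∈L₂)))) (there x∈L₂)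
         (there (∈L₁ (x∈p∪q⁺ (inj₁ y∈L₂)))) (there y∈L₂)))
    where
    ∈L₁ : ∀ {z} → z ∈ L₂ ∪ ⁅ v₂ ⁆ → z ∈ L₁
    ∈L₁ = subst (_ ∈_) (sym L₁≡L₂∪⁅v₂⁆)
    v₁≢1+v₂ : v₁ ≢ suc v₂
    v₁≢1+v₂ refl = centre∉ star₁ (there (∈L₁ (x∈p∪q⁺ (inj₂ (x∈⁅x⁆ v₂)))))

  -- Distinct centres would both be adjacent to 0 and to any leaf x ≠ v₂ of L₁.
  replaceZeroByCentre-inside⇒centre≡ : {v₁ v₂ : Fin m} {L₁ L₂ : Subset m} → 2 < k →
    IsStar G k (suc v₁) (inside ∷ L₁) → IsStar G k (suc v₂) (inside ∷ L₂) →
    replaceZeroByCentre (suc v₁ , inside ∷ L₁) ≡ replaceZeroByCentre (suc v₂ , inside ∷ L₂) → v₁ ≡ v₂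
  replaceZeroByCentre-inside⇒centre≡ {v₁ = v₁} {v₂} 2<k star₁ star₂ eq with v₁ ≟ v₂
  ... | yes v₁≡v₂ = v₁≡v₂
  ... | no  v₁≢v₂ =
    let x , x∈L₁ , x≢v₂ = ∣p∣>1⇒∃∈≢ (IsStar-inside⇒1<∣L∣ 2<k star₁) v₂
        x∈L₂ = x∈p∪⁅y⁆⇒x∈p (subst (x ∈_) eq (x∈p∪q⁺ (inj₁ x∈L₁))) x≢v₂
    in ⊥-elim (0≢1+n (IsStar-sharedLeaf-unique free star₁ star₂ (v₁≢v₂ ∘ suc-injective)
         here here (there x∈L₁) (there x∈L₂)))

  replaceZeroByCentre-injective : {v₁ v₂ : Fin (suc m)} {L₁ L₂ : Subset (suc m)} → 2 < k →
    IsStar G k v₁ L₁ → IsStar G k v₂ L₂ →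
    replaceZeroByCentre (v₁ , L₁) ≡ replaceZeroByCentre (v₂ , L₂) → (v₁ , L₁) ≡ (v₂ , L₂)
  replaceZeroByCentre-injective {v₁ = zero} {L₁ = inside ∷ _} _ star₁ _ _ = ⊥-elim (centre∉ star₁ here)
  replaceZeroByCentre-injective {v₂ = zero} {L₂ = inside ∷ _} _ _ star₂ _ = ⊥-elim (centre∉ star₂ here)
  replaceZeroByCentre-injective {L₁ = outside ∷ L} {L₂ = outside ∷ _} 2<k star₁ star₂ refl =
    cong (_, outside ∷ L)
      (IsStar-centre-unique free (subst (1 <_) (sym (size star₁)) (<⇒≤ 2<k)) star₁ star₂)
  replaceZeroByCentre-injective {v₂ = suc _} {L₁ = outside ∷ _} {L₂ = inside ∷ _} 2<k star₁ star₂ eq =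
    ⊥-elim (replaceZeroByCentre-separates 2<k star₁ star₂ eq)
  replaceZeroByCentre-injective {v₁ = suc _} {L₁ = inside ∷ _} {L₂ = outside ∷ _} 2<k star₁ star₂ eq =
    ⊥-elim (replaceZeroByCentre-separates 2<k star₂ star₁ (sym eq))
  replaceZeroByCentre-injective {v₁ = suc v₁} {v₂ = suc _} {L₁ = inside ∷ _} {L₂ = inside ∷ _}
    2<k star₁ star₂ eq with refl ← replaceZeroByCentre-inside⇒centre≡ 2<k star₁ star₂ eq =
    cong (λ L → suc v₁ , inside ∷ L) (∪⁅x⁆-injective (centre∉ star₁ ∘ there) (centre∉ star₂ ∘ there) eq)

starCount-≤ : (r : ℕ) (G : Graph (suc m)) → C4Free G → 2 < r ∸ 1 → starCount G r ≤ m C (r ∸ 1)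
starCount-≤ {m} r G free 2<k = begin
  starCount G r
    ≤⟨ length-filterᵇ-≤-injection (isStarCopy G r) (λ L → ∣ L ∣ ≡ᵇ r ∸ 1) replaceZeroByCentre
         (Unique-centredSubsets (suc m)) ∈-allSubsets
         (λ vL → ≡⇒≡ᵇ _ _ ∘ IsStar⇒∣replaceZeroByCentre∣ ∘ star vL)
         (λ vL₁ vL₂ isStar₁ isStar₂ →
            replaceZeroByCentre-injective free 2<k (star vL₁ isStar₁) (star vL₂ isStar₂)) ⟩
  length (ofSize (r ∸ 1) (allSubsets m))
    ≡⟨ length-ofSize-allSubsets m (r ∸ 1) ⟩
  m C (r ∸ 1)
    ∎
  where
  open ≤-Reasoning
  star : (vL : Fin (suc m) × Subset (suc m)) →
    T (isStarCopy G r vL) → IsStar G (r ∸ 1) (proj₁ vL) (proj₂ vL)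
  star = isStarCopy⇒IsStar G r

starAdj : Fin (suc m) → Fin (suc m) → Bool
starAdj zero    zero    = false
starAdj zero    (suc _) = true
starAdj (suc _) zero    = true
starAdj (suc _) (suc _) = false

starAdj-sym : (x y : Fin (suc m)) → starAdj x y ≡ starAdj y x
starAdj-sym zero    zero    = refl
starAdj-sym zero    (suc _) = refl
starAdj-sym (suc _) zero    = refl
starAdj-sym (suc _) (suc _) = refl

starAdj-irrefl : (x : Fin (suc m)) → starAdj x x ≡ false
starAdj-irrefl zero    = refl
starAdj-irrefl (suc _) = refl

starGraph : ∀ m → Graph (suc m)
starGraph m = record { adj = starAdj ; sym = starAdj-sym ; irrefl = starAdj-irrefl }

starGraph-3-walk : (a b c d : Fin (suc m)) →
  Adj (starGraph m) a b → Adj (starGraph m) b c → Adj (starGraph m) c d → a ≡ c ⊎ b ≡ d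
starGraph-3-walk zero    zero    _       _       ()
starGraph-3-walk zero    (suc _) zero    _       _ _ _ = inj₁ refl
starGraph-3-walk zero    (suc _) (suc _) _       _ ()
starGraph-3-walk (suc _) (suc _) _       _       ()
starGraph-3-walk (suc _) zero    zero    _       _ ()
starGraph-3-walk (suc _) zero    (suc _) zero    _ _ _ = inj₂ refl
starGraph-3-walk (suc _) zero    (suc _) (suc _) _ _ ()

starGraph-C4Free : C4Free (starGraph m)
starGraph-C4Free (a , b , c , d , _ , a≢c , _ , _ , b≢d , _ , a~b , b~c , c~d , _) =
  [ a≢c , b≢d ] (starGraph-3-walk a b c d a~b b~c c~d)

starGraph-starCount-≥ : (m r : ℕ) → m C (r ∸ 1) ≤ starCount (starGraph m) r
starGraph-starCount-≥ m r = begin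
  m C (r ∸ 1)
    ≡⟨ length-ofSize-allSubsets m (r ∸ 1) ⟨
  length (ofSize (r ∸ 1) (allSubsets m))
    ≤⟨ length-filterᵇ-≤-injection (λ L → ∣ L ∣ ≡ᵇ r ∸ 1) (isStarCopy (starGraph m) r)
         (λ L → zero , outside ∷ L) (Unique-allSubsets m) ∈-centredSubsets
         (λ L ∣L∣≡k →
            IsStar⇒isStarCopy (starGraph m) r (zero , outside ∷ L) (starGraph-IsStar (≡ᵇ⇒≡ ∣ L ∣ _ ∣L∣≡k)))
         (λ _ _ _ _ → cong (tail ∘ proj₂)) ⟩
  starCount (starGraph m) r
    ∎
  where
  open ≤-Reasoning
  starGraph-IsStar : {L : Subset m} → ∣ L ∣ ≡ k → IsStar (starGraph m) k zero (outside ∷ L)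
  starGraph-IsStar ∣L∣≡k = record { size = ∣L∣≡k ; centre∉ = λ () ; adjacent = λ { (there _) → _ } }

emptyGraph : Graph 0
emptyGraph = record { adj = λ () ; sym = λ () ; irrefl = λ () }

proposition3p2 : (r n : ℕ) → 4 ≤ r →
    ((G : Graph n) → C4Free G → starCount G r ≤ (n ∸ 1) C (r ∸ 1))
    × (Σ (Graph n) λ G → (C4Free G × starCount G r ≡ (n ∸ 1) C (r ∸ 1)))
-- With no vertices both sides are 0, as 0 C (r ∸ 1) = 0 once r ≥ 2.
proposition3p2 _ zero (s≤s (s≤s _)) = (λ _ _ → z≤n) , emptyGraph , (λ ()) , refl
proposition3p2 r (suc m) (s≤s 2<r∸1) =
  (λ G free → starCount-≤ r G free 2<r∸1) ,
  starGraph m , starGraph-C4Free ,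
  ≤-antisym (starCount-≤ r (starGraph m) starGraph-C4Free 2<r∸1) (starGraph-starCount-≥ m r)
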